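{- Let $p>2$ be a prime, let $X,Y\subset\mathbb{Z}_p$ with $|Y|>1$, and let $\xi\in Q[X,Y]$. Then $$|2XY-2XY|\geq|X+\xi*Y|.$$
   Context: $\mathbb{Z}_p$ is the field of residues modulo $p$. For $X,Y\subset\mathbb{Z}_p$ with $|Y|>1$, $Q[X,Y]=\left\{\frac{x_1-x_2}{y_1-y_2}:\ x_1,x_2\in X,\ y_1,y_2\in Y,\ y_1\neq y_2\right\}$. $XY=\{xy:x\in X,y\in Y\}$, $\xi*Y=\{\xi y: y\in Y\}$, $kS=\{s_1+\dots+s_k:\ s_i\in S\}$, and $S+T=\{s+t\}$, $S-T=\{s-t\}$ elementwise; so $2XY-2XY=\{s_1-s_2:\ s_1,s_2\in 2(XY)\}$. -}

module Defs where

open import Data.Nat using (ℕ; NonZero; _+_; _*_; _∸_)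
open import Data.Nat.DivMod using (_mod_)
open import Data.Fin using (Fin; toℕ; _≟_)
open import Data.Fin.Subset using (Subset; _∈_)
open import Data.Fin.Subset.Properties using (_∈?_)
open import Data.Fin.Properties using (any?)
open import Data.Vec using (tabulate)
open import Data.Product using (Σ; _×_; _,_)
open import Relation.Nullary using (¬_)
open import Relation.Nullary.Decidable using (⌊_⌋; _×-dec_)
open import Relation.Binary.PropositionalEquality using (_≡_)

module _ {p : ℕ} .{{_ : NonZero p}} where

  _+ₚ_ : Fin p → Fin p → Fin p
  a +ₚ b = (toℕ a + toℕ b) mod p

  _-ₚ_ : Fin p → Fin p → Fin p
  a -ₚ b = (toℕ a + (p ∸ toℕ b)) mod p

  _*ₚ_ : Fin p → Fin p → Fin p
  a *ₚ b = (toℕ a * toℕ b) mod p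

  image2 : (Fin p → Fin p → Fin p) → Subset p → Subset p → Subset p
  image2 f A B = tabulate λ z →
    ⌊ any? (λ x → any? (λ y → (x ∈? A) ×-dec ((y ∈? B) ×-dec (f x y ≟ z)))) ⌋

  prodSet : Subset p → Subset p → Subset p
  prodSet = image2 _*ₚ_

  sumSet : Subset p → Subset p → Subset p
  sumSet = image2 _+ₚ_

  diffSet : Subset p → Subset p → Subset p
  diffSet = image2 _-ₚ_

  twoXYminusTwoXY : Subset p → Subset p → Subset p
  twoXYminusTwoXY X Y = diffSet (sumSet (prodSet X Y) (prodSet X Y))
                                (sumSet (prodSet X Y) (prodSet X Y))

  plusDilate : Subset p → Fin p → Subset p → Subset p
  plusDilate X ξ Y = image2 (λ x y → x +ₚ (ξ *ₚ y)) X Y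

  -- ξ ∈ Q[X,Y]: ξ = (x₁ - x₂)/(y₁ - y₂) with y₁ ≠ y₂ (division in the field ℤ_p,
  -- i.e. ξ · (y₁ - y₂) = x₁ - x₂)
  InQ : Fin p → Subset p → Subset p → Set
  InQ ξ X Y = Σ (Fin p) λ x₁ → Σ (Fin p) λ x₂ → Σ (Fin p) λ y₁ → Σ (Fin p) λ y₂ →
    x₁ ∈ X × x₂ ∈ X × y₁ ∈ Y × y₂ ∈ Y × ¬ (y₁ ≡ y₂) ×
    (ξ *ₚ (y₁ -ₚ y₂) ≡ x₁ -ₚ x₂)

-- Write ξ = (x₁ − x₂)/(y₁ − y₂). Multiplication by c = y₁ − y₂ ≠ 0 is injective on ℤ_p, and
-- c (x + ξ y) = (x y₁ + x₁ y) − (x y₂ + x₂ y), so it maps X + ξ*Y injectively into 2XY − 2XY.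
-- Residue arithmetic is checked on integer representatives modulo p.
module Submission where

open import Defs
open import Data.Nat as ℕ using (ℕ; suc; NonZero; _<_; _≤_; _%_; _/_; _∸_)
open import Data.Nat.Properties as ℕ using (1+n≰n; ⊔-lub; +-0-commutativeMonoid)
open import Data.Nat.DivMod using (_mod_; m≡m%n+[m/n]*n; m<n⇒m%n≡m; m%n<n)
open import Data.Nat.Divisibility as ℕ using (n∣m⇒m%n≡0)
open import Data.Nat.Primality using (Prime; euclidsLemma)
open import Data.Integer as ℤ using (ℤ; +_; _+_; _-_; _*_; -_; _⊖_; 0ℤ)
open import Data.Integer.Properties
  using ( +-identityʳ; +-inverseʳ; abs-*; pos-+; pos-*; +-injective; ⊖-≥; m-n≡m⊖n
        ; ∣m⊝n∣≤m⊔n; ∣i∣≡0⇒i≡0; i-j≡0⇒i≡j)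
open import Data.Integer.Divisibility.Signed
  using (_∣_; divides; ∣m∣n⇒∣m+n; ∣m⇒∣-m; ∣m⇒∣m*n; ∣n⇒∣m*n; ∣⇒∣ᵤ; ∣ᵤ⇒∣)
open import Data.Integer.Tactic.RingSolver using (solve-∀)
open import Data.Bool using (Bool; true; false; if_then_else_)
open import Data.Bool.Properties using (T-≡)
open import Data.Fin using (Fin; zero; suc; toℕ; punchOut; _≟_)
open import Data.Fin.Properties using (any?; injective⇒≤; punchOut-injective; toℕ<n; toℕ-injective; toℕ-fromℕ<)
open import Data.Fin.Permutation using (Permutation; permutation; _⟨$⟩ʳ_)
open import Data.Fin.Subset using (Subset; _∈_; _⊆_; ∣_∣)
open import Data.Fin.Subset.Properties using (p⊆q⇒∣p∣≤∣q∣)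
open import Data.Vec using (lookup; tabulate)
open import Data.Vec.Properties using (lookup⇒[]=; []=⇒lookup; lookup∘tabulate; tabulate∘lookup)
open import Data.Product using (∃; ∃₂; _×_; _,_; proj₁; proj₂)
open import Data.Sum as Sum using (_⊎_; [_,_]′)
open import Function.Base using (_∘_)
open import Function.Bundles using (Equivalence)
open import Function.Definitions using (Injective)
open import Relation.Nullary using (¬_; yes; no; contradiction)
open import Relation.Nullary.Decidable using (toWitness; fromWitness)
open import Relation.Binary.Bundles using (Setoid)
import Relation.Binary.Reasoning.Setoid as SetoidReasoning
open import Relation.Binary.PropositionalEquality
open import Algebra.Properties.CommutativeMonoid.Sum +-0-commutativeMonoid using (sum; sum-permute)

module Congruence (m : ℕ) where

  infix 4 _≈_

  -- A record rather than a synonym for + m ∣ i - j, so that i and j are inferable from i ≈ j.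
  record _≈_ (i j : ℤ) : Set where
    constructor mk≈
    field
      m∣i-j : + m ∣ i - j

  ≈-reflexive : ∀ {i j} → i ≡ j → i ≈ j
  ≈-reflexive {i} refl = mk≈ (divides 0ℤ (+-inverseʳ i))

  ≈-refl : ∀ {i} → i ≈ i
  ≈-refl = ≈-reflexive refl

  ≈-sym : ∀ {i j} → i ≈ j → j ≈ i
  ≈-sym {i} {j} (mk≈ m∣i-j) = mk≈ (subst (+ m ∣_) (flip i j) (∣m⇒∣-m m∣i-j))
    where
    flip : ∀ i j → - (i - j) ≡ j - i
    flip = solve-∀

  ≈-trans : ∀ {i j k} → i ≈ j → j ≈ k → i ≈ k
  ≈-trans {i} {j} {k} (mk≈ m∣i-j) (mk≈ m∣j-k) =
    mk≈ (subst (+ m ∣_) (telescope i j k) (∣m∣n⇒∣m+n m∣i-j m∣j-k))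
    where
    telescope : ∀ i j k → (i - j) + (j - k) ≡ i - k
    telescope = solve-∀

  ≈-setoid : Setoid _ _
  ≈-setoid = record
    { Carrier = ℤ
    ; _≈_ = _≈_
    ; isEquivalence = record { refl = ≈-refl ; sym = ≈-sym ; trans = ≈-trans }
    }

  module ≈-Reasoning = SetoidReasoning ≈-setoid

  i+j*m≈i : ∀ i j → i + j * + m ≈ i
  i+j*m≈i i j = mk≈ (divides j (cancel i (j * + m)))
    where
    cancel : ∀ i k → (i + k) - i ≡ k
    cancel = solve-∀

  +-cong : ∀ {i j k l} → i ≈ j → k ≈ l → i + k ≈ j + l
  +-cong {i} {j} {k} {l} (mk≈ m∣i-j) (mk≈ m∣k-l) =
    mk≈ (subst (+ m ∣_) (regroup i j k l) (∣m∣n⇒∣m+n m∣i-j m∣k-l))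
    where
    regroup : ∀ i j k l → (i - j) + (k - l) ≡ (i + k) - (j + l)
    regroup = solve-∀

  *-cong : ∀ {i j k l} → i ≈ j → k ≈ l → i * k ≈ j * l
  *-cong {i} {j} {k} {l} (mk≈ m∣i-j) (mk≈ m∣k-l) =
    mk≈ (subst (+ m ∣_) (regroup i j k l) (∣m∣n⇒∣m+n (∣m⇒∣m*n k m∣i-j) (∣n⇒∣m*n j m∣k-l)))
    where
    regroup : ∀ i j k l → (i - j) * k + j * (k - l) ≡ i * k - j * l
    regroup = solve-∀

  -‿cong : ∀ {i j} → i ≈ j → - i ≈ - j
  -‿cong {i} {j} (mk≈ m∣i-j) = mk≈ (subst (+ m ∣_) (negate i j) (∣m⇒∣-m m∣i-j))
    where
    negate : ∀ i j → - (i - j) ≡ - i - - j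
    negate = solve-∀

  ∣⇒≈0 : ∀ {i} → + m ∣ i → i ≈ 0ℤ
  ∣⇒≈0 {i} m∣i = mk≈ (subst (+ m ∣_) (sym (+-identityʳ i)) m∣i)

  ≈0⇒∣ : ∀ {i} → i ≈ 0ℤ → + m ∣ i
  ≈0⇒∣ {i} (mk≈ m∣i-0) = subst (+ m ∣_) (+-identityʳ i) m∣i-0

  euclidsLemmaℤ : Prime m → ∀ i j → + m ∣ i * j → (+ m ∣ i) ⊎ (+ m ∣ j)
  euclidsLemmaℤ m-prime i j m∣ij = Sum.map ∣ᵤ⇒∣ ∣ᵤ⇒∣
    (euclidsLemma ℤ.∣ i ∣ ℤ.∣ j ∣ m-prime (subst (m ℕ.∣_) (abs-* i j) (∣⇒∣ᵤ m∣ij)))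

  *-cancelˡ-≈ : Prime m → ∀ {i j k} → ¬ (i ≈ 0ℤ) → i * j ≈ i * k → j ≈ k
  *-cancelˡ-≈ m-prime {i} {j} {k} i≉0 (mk≈ m∣ij-ik) =
    [ (λ m∣i → contradiction (∣⇒≈0 m∣i) i≉0) , mk≈ ]′
      (euclidsLemmaℤ m-prime i (j - k) (subst (+ m ∣_) (factor i j k) m∣ij-ik))
    where
    factor : ∀ i j k → i * j - i * k ≡ i * (j - k)
    factor = solve-∀

preimage : ∀ {m n} → (Fin m → Fin n) → Subset n → Subset m
preimage f q = tabulate (lookup q ∘ f)

indicator : Bool → ℕ
indicator b = if b then 1 else 0

∣tabulate∣≡sum : ∀ {n} (g : Fin n → Bool) → ∣ tabulate g ∣ ≡ sum (indicator ∘ g)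
∣tabulate∣≡sum {ℕ.zero} g = refl
∣tabulate∣≡sum {suc n} g with g zero
... | true  = cong suc (∣tabulate∣≡sum (g ∘ suc))
... | false = ∣tabulate∣≡sum (g ∘ suc)

injective⇒preimage : ∀ {n} {f : Fin n → Fin n} → Injective _≡_ _≡_ f → ∀ y → ∃ λ x → f x ≡ y
injective⇒preimage {ℕ.zero} _ ()
injective⇒preimage {suc _} {f} f-inj y with any? (λ x → f x ≟ y)
... | yes found = found
... | no none = contradiction (injective⇒≤ f-punchOut-injective) 1+n≰n
  where
  missing : ∀ x → f x ≢ y
  missing x fx≡y = none (x , fx≡y)
  f-punchOut-injective : Injective _≡_ _≡_ (λ x → punchOut (missing x ∘ sym))
  f-punchOut-injective {a} {b} = f-inj ∘ punchOut-injective (missing a ∘ sym) (missing b ∘ sym)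

∣preimage∣≡∣q∣ : ∀ {n} (π : Permutation n n) (q : Subset n) → ∣ preimage (π ⟨$⟩ʳ_) q ∣ ≡ ∣ q ∣
∣preimage∣≡∣q∣ π q = begin
  ∣ preimage (π ⟨$⟩ʳ_) q ∣                  ≡⟨ ∣tabulate∣≡sum (lookup q ∘ (π ⟨$⟩ʳ_)) ⟩
  sum (indicator ∘ lookup q ∘ (π ⟨$⟩ʳ_))   ≡⟨ sum-permute (indicator ∘ lookup q) π ⟨
  sum (indicator ∘ lookup q)               ≡⟨ ∣tabulate∣≡sum (lookup q) ⟨
  ∣ tabulate (lookup q) ∣                  ≡⟨ cong ∣_∣ (tabulate∘lookup q) ⟩
  ∣ q ∣                                    ∎
  where open ≡-Reasoning

injective⇒permutation : ∀ {n} {f : Fin n → Fin n} → Injective _≡_ _≡_ f → Permutation n n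
injective⇒permutation {f = f} f-inj =
  permutation f f⁻¹ (proj₂ ∘ preimageOf) (λ x → f-inj (proj₂ (preimageOf (f x))))
  where
  preimageOf = injective⇒preimage f-inj
  f⁻¹ = proj₁ ∘ preimageOf

injective⇒∣p∣≤∣q∣ : ∀ {n} {f : Fin n → Fin n} {p q : Subset n} → Injective _≡_ _≡_ f →
                    (∀ {x} → x ∈ p → f x ∈ q) → ∣ p ∣ ≤ ∣ q ∣
injective⇒∣p∣≤∣q∣ {f = f} {p} {q} f-inj f[p]⊆q = begin
  ∣ p ∣              ≤⟨ p⊆q⇒∣p∣≤∣q∣ p⊆f⁻¹[q] ⟩
  ∣ preimage f q ∣   ≡⟨ ∣preimage∣≡∣q∣ (injective⇒permutation f-inj) q ⟩
  ∣ q ∣              ∎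
  where
  open ℕ.≤-Reasoning
  p⊆f⁻¹[q] : p ⊆ preimage f q
  p⊆f⁻¹[q] {x} x∈p = lookup⇒[]= x _ (trans (lookup∘tabulate _ x) ([]=⇒lookup (f[p]⊆q x∈p)))

module _ {p : ℕ} .{{_ : NonZero p}} {f : Fin p → Fin p → Fin p} {A B : Subset p} where

  ∈-image2⁺ : ∀ {x y} → x ∈ A → y ∈ B → f x y ∈ image2 f A B
  ∈-image2⁺ {x} {y} x∈A y∈B = lookup⇒[]= (f x y) _
    (trans (lookup∘tabulate _ (f x y)) (Equivalence.to T-≡ (fromWitness (x , y , x∈A , y∈B , refl))))

  ∈-image2⁻ : ∀ {z} → z ∈ image2 f A B → ∃₂ λ x y → x ∈ A × y ∈ B × f x y ≡ z
  ∈-image2⁻ {z} z∈image =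
    toWitness (Equivalence.from T-≡ (trans (sym (lookup∘tabulate _ z)) ([]=⇒lookup z∈image)))

module Residues {p : ℕ} .{{_ : NonZero p}} where

  open Congruence p

  ⟦_⟧ : Fin p → ℤ
  ⟦ a ⟧ = + toℕ a

  ⟦mod⟧ : ∀ n → ⟦ n mod p ⟧ ≈ + n
  ⟦mod⟧ n = begin
    ⟦ n mod p ⟧                  ≡⟨ cong +_ (toℕ-fromℕ< (m%n<n n p)) ⟩
    + (n % p)                    ≈⟨ i+j*m≈i (+ (n % p)) (+ (n / p)) ⟨
    + (n % p) + + (n / p) * + p  ≡⟨ cong (_+_ (+ (n % p))) (pos-* (n / p) p) ⟨
    + (n % p) + + (n / p ℕ.* p)  ≡⟨ pos-+ (n % p) _ ⟨
    + (n % p ℕ.+ n / p ℕ.* p)    ≡⟨ cong +_ (m≡m%n+[m/n]*n n p) ⟨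
    + n                          ∎
    where open ≈-Reasoning

  ⟦+ₚ⟧ : ∀ a b → ⟦ a +ₚ b ⟧ ≈ ⟦ a ⟧ + ⟦ b ⟧
  ⟦+ₚ⟧ a b = ≈-trans (⟦mod⟧ _) (≈-reflexive (pos-+ (toℕ a) (toℕ b)))

  ⟦*ₚ⟧ : ∀ a b → ⟦ a *ₚ b ⟧ ≈ ⟦ a ⟧ * ⟦ b ⟧
  ⟦*ₚ⟧ a b = ≈-trans (⟦mod⟧ _) (≈-reflexive (pos-* (toℕ a) (toℕ b)))

  ⟦-ₚ⟧ : ∀ a b → ⟦ a -ₚ b ⟧ ≈ ⟦ a ⟧ - ⟦ b ⟧
  ⟦-ₚ⟧ a b = begin
    ⟦ a -ₚ b ⟧                  ≈⟨ ⟦mod⟧ _ ⟩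
    + (toℕ a ℕ.+ (p ∸ toℕ b))   ≡⟨ pos-+ (toℕ a) _ ⟩
    ⟦ a ⟧ + + (p ∸ toℕ b)       ≡⟨ cong (_+_ ⟦ a ⟧) +[p∸b]≡p-b ⟩
    ⟦ a ⟧ + (+ p - ⟦ b ⟧)       ≡⟨ regroup ⟦ a ⟧ ⟦ b ⟧ (+ p) ⟩
    ⟦ a ⟧ - ⟦ b ⟧ + + 1 * + p   ≈⟨ i+j*m≈i (⟦ a ⟧ - ⟦ b ⟧) (+ 1) ⟩
    ⟦ a ⟧ - ⟦ b ⟧               ∎
    where
    open ≈-Reasoning
    +[p∸b]≡p-b : + (p ∸ toℕ b) ≡ + p - ⟦ b ⟧
    +[p∸b]≡p-b = trans (sym (⊖-≥ (ℕ.<⇒≤ (toℕ<n b)))) (sym (m-n≡m⊖n p (toℕ b)))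
    regroup : ∀ i j k → i + (k - j) ≡ i - j + + 1 * k
    regroup = solve-∀

  ≈⇒≡ : ∀ {a b} → ⟦ a ⟧ ≈ ⟦ b ⟧ → a ≡ b
  ≈⇒≡ {a} {b} (mk≈ p∣a-b) = toℕ-injective (+-injective (i-j≡0⇒i≡j ⟦ a ⟧ ⟦ b ⟧ (∣i∣≡0⇒i≡0 ∣a-b∣≡0)))
    where
    ∣a-b∣<p : ℤ.∣ ⟦ a ⟧ - ⟦ b ⟧ ∣ ℕ.< p
    ∣a-b∣<p = begin-strict
      ℤ.∣ ⟦ a ⟧ - ⟦ b ⟧ ∣    ≡⟨ cong ℤ.∣_∣ (m-n≡m⊖n (toℕ a) (toℕ b)) ⟩
      ℤ.∣ toℕ a ⊖ toℕ b ∣   ≤⟨ ∣m⊝n∣≤m⊔n (toℕ a) (toℕ b) ⟩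
      toℕ a ℕ.⊔ toℕ b     <⟨ ⊔-lub (toℕ<n a) (toℕ<n b) ⟩
      p                   ∎
      where open ℕ.≤-Reasoning
    ∣a-b∣≡0 : ℤ.∣ ⟦ a ⟧ - ⟦ b ⟧ ∣ ≡ 0
    ∣a-b∣≡0 = trans (sym (m<n⇒m%n≡m ∣a-b∣<p)) (n∣m⇒m%n≡0 _ p (∣⇒∣ᵤ p∣a-b))

  *ₚ-cancelˡ : Prime p → ∀ {c} → ¬ (⟦ c ⟧ ≈ 0ℤ) → Injective _≡_ _≡_ (c *ₚ_)
  *ₚ-cancelˡ p-prime {c} c≉0 {a} {b} ca≡cb = ≈⇒≡ (*-cancelˡ-≈ p-prime c≉0 (begin
    ⟦ c ⟧ * ⟦ a ⟧   ≈⟨ ⟦*ₚ⟧ c a ⟨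
    ⟦ c *ₚ a ⟧      ≡⟨ cong ⟦_⟧ ca≡cb ⟩
    ⟦ c *ₚ b ⟧      ≈⟨ ⟦*ₚ⟧ c b ⟩
    ⟦ c ⟧ * ⟦ b ⟧   ∎))
    where open ≈-Reasoning

  -ₚ-≉0 : ∀ {a b} → a ≢ b → ¬ (⟦ a -ₚ b ⟧ ≈ 0ℤ)
  -ₚ-≉0 {a} {b} a≢b a-b≈0 = a≢b (≈⇒≡ (mk≈ (≈0⇒∣ (≈-trans (≈-sym (⟦-ₚ⟧ a b)) a-b≈0))))

  denominator-*ₚ-dilate : ∀ {ξ x₁ x₂ y₁ y₂} → ξ *ₚ (y₁ -ₚ y₂) ≡ x₁ -ₚ x₂ → ∀ x y →
    (y₁ -ₚ y₂) *ₚ (x +ₚ (ξ *ₚ y)) ≡ ((x *ₚ y₁) +ₚ (x₁ *ₚ y)) -ₚ ((x *ₚ y₂) +ₚ (x₂ *ₚ y))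
  denominator-*ₚ-dilate {ξ} {x₁} {x₂} {y₁} {y₂} ξ-eq x y = ≈⇒≡ (begin
    ⟦ (y₁ -ₚ y₂) *ₚ (x +ₚ (ξ *ₚ y)) ⟧       ≈⟨ ⟦*ₚ⟧ (y₁ -ₚ y₂) _ ⟩
    ⟦ y₁ -ₚ y₂ ⟧ * ⟦ x +ₚ (ξ *ₚ y) ⟧        ≈⟨ *-cong (⟦-ₚ⟧ y₁ y₂) ⟦x+ₚξ*ₚy⟧ ⟩
    (Y₁ - Y₂) * (X + Ξ * Y)                 ≡⟨ expand Y₁ Y₂ X Ξ Y ⟩
    (Y₁ - Y₂) * X + Ξ * (Y₁ - Y₂) * Y       ≈⟨ +-cong (≈-refl {(Y₁ - Y₂) * X}) (*-cong ξ[y₁-y₂]≈x₁-x₂ (≈-refl {Y})) ⟩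
    (Y₁ - Y₂) * X + (X₁ - X₂) * Y           ≡⟨ regroup Y₁ Y₂ X X₁ X₂ Y ⟩
    (X * Y₁ + X₁ * Y) - (X * Y₂ + X₂ * Y)   ≈⟨ +-cong (⟦+ₚ*ₚ⟧ x y₁ x₁ y) (-‿cong (⟦+ₚ*ₚ⟧ x y₂ x₂ y)) ⟨
    ⟦ s₁ ⟧ - ⟦ s₂ ⟧                         ≈⟨ ⟦-ₚ⟧ s₁ s₂ ⟨
    ⟦ s₁ -ₚ s₂ ⟧                            ∎)
    where
    open ≈-Reasoning
    X = ⟦ x ⟧ ; Y = ⟦ y ⟧ ; Ξ = ⟦ ξ ⟧
    X₁ = ⟦ x₁ ⟧ ; X₂ = ⟦ x₂ ⟧ ; Y₁ = ⟦ y₁ ⟧ ; Y₂ = ⟦ y₂ ⟧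
    s₁ = (x *ₚ y₁) +ₚ (x₁ *ₚ y)
    s₂ = (x *ₚ y₂) +ₚ (x₂ *ₚ y)
    expand : ∀ Y₁ Y₂ X Ξ Y → (Y₁ - Y₂) * (X + Ξ * Y) ≡ (Y₁ - Y₂) * X + Ξ * (Y₁ - Y₂) * Y
    expand = solve-∀
    regroup : ∀ Y₁ Y₂ X X₁ X₂ Y →
              (Y₁ - Y₂) * X + (X₁ - X₂) * Y ≡ (X * Y₁ + X₁ * Y) - (X * Y₂ + X₂ * Y)
    regroup = solve-∀
    ⟦x+ₚξ*ₚy⟧ : ⟦ x +ₚ (ξ *ₚ y) ⟧ ≈ X + Ξ * Y
    ⟦x+ₚξ*ₚy⟧ = ≈-trans (⟦+ₚ⟧ x (ξ *ₚ y)) (+-cong (≈-refl {X}) (⟦*ₚ⟧ ξ y))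
    ⟦+ₚ*ₚ⟧ : ∀ a b c d → ⟦ (a *ₚ b) +ₚ (c *ₚ d) ⟧ ≈ ⟦ a ⟧ * ⟦ b ⟧ + ⟦ c ⟧ * ⟦ d ⟧
    ⟦+ₚ*ₚ⟧ a b c d = ≈-trans (⟦+ₚ⟧ (a *ₚ b) (c *ₚ d)) (+-cong (⟦*ₚ⟧ a b) (⟦*ₚ⟧ c d))
    ξ[y₁-y₂]≈x₁-x₂ : Ξ * (Y₁ - Y₂) ≈ X₁ - X₂
    ξ[y₁-y₂]≈x₁-x₂ = begin
      Ξ * (Y₁ - Y₂)        ≈⟨ *-cong (≈-refl {Ξ}) (⟦-ₚ⟧ y₁ y₂) ⟨
      Ξ * ⟦ y₁ -ₚ y₂ ⟧     ≈⟨ ⟦*ₚ⟧ ξ _ ⟨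
      ⟦ ξ *ₚ (y₁ -ₚ y₂) ⟧  ≡⟨ cong ⟦_⟧ ξ-eq ⟩
      ⟦ x₁ -ₚ x₂ ⟧         ≈⟨ ⟦-ₚ⟧ x₁ x₂ ⟩
      X₁ - X₂              ∎

lemma6 : (p : ℕ) .{{_ : NonZero p}} → Prime p → 2 < p →
         (X Y : Subset p) → 1 < ∣ Y ∣ →
         (ξ : Fin p) → InQ ξ X Y →
         ∣ plusDilate X ξ Y ∣ ≤ ∣ twoXYminusTwoXY X Y ∣
lemma6 p p-prime _ X Y _ ξ (x₁ , x₂ , y₁ , y₂ , x₁∈X , x₂∈X , y₁∈Y , y₂∈Y , y₁≢y₂ , ξ-eq) =
  injective⇒∣p∣≤∣q∣ (*ₚ-cancelˡ p-prime (-ₚ-≉0 y₁≢y₂)) denominator-maps-into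
  where
  open Residues {p}
  denominator-maps-into : ∀ {z} → z ∈ plusDilate X ξ Y → (y₁ -ₚ y₂) *ₚ z ∈ twoXYminusTwoXY X Y
  denominator-maps-into z∈X+ξY with x , y , x∈X , y∈Y , refl ← ∈-image2⁻ z∈X+ξY =
    subst (_∈ twoXYminusTwoXY X Y) (sym (denominator-*ₚ-dilate {ξ} {x₁} {x₂} {y₁} {y₂} ξ-eq x y))
      (∈-image2⁺ (∈-image2⁺ (∈-image2⁺ x∈X y₁∈Y) (∈-image2⁺ x₁∈X y∈Y))
                 (∈-image2⁺ (∈-image2⁺ x∈X y₂∈Y) (∈-image2⁺ x₂∈X y∈Y)))
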